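{- For all positive integers $k\leq n$, $$\mathrm{ex}(K_{n,n,n,n},kK_3)\geq 4n^2+(k-1)n.$$
   Context: For graphs $G$ and $H$, $\mathrm{ex}(G,H)$ denotes the maximum number of edges in a subgraph of $G$ containing no copy of $H$. $K_{n,n,n,n}$ is the complete $4$-partite graph with all four parts of size $n$, and $kK_3$ denotes the disjoint union of $k$ vertex-disjoint triangles. -}

module Defs where

open import Data.Nat using (ℕ; _+_; _*_; ⌊_/2⌋)
open import Data.Fin using (Fin)
open import Data.Bool using (Bool; true; false; if_then_else_; T)
open import Data.Product using (Σ; _×_; _,_)
open import Data.List using (List; map; cartesianProduct; allFin)
open import Data.Nat.ListAction using (sum)
open import Relation.Binary.PropositionalEquality using (_≡_; _≢_)
open import Relation.Nullary using (¬_)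
open import Function.Definitions using (Injective)

-- Vertices of K_{n,n,n,n}: (part, index within part); four parts of size n.
Vtx : ℕ → Set
Vtx n = Fin 4 × Fin n

HostAdj : ∀ {n} → Vtx n → Vtx n → Set
HostAdj (p , _) (q , _) = p ≢ q

record SubgraphK4 (n : ℕ) : Set where
  field
    adj  : Vtx n → Vtx n → Bool
    sym  : ∀ u v → adj u v ≡ adj v u
    sub  : ∀ u v → T (adj u v) → HostAdj u v
open SubgraphK4 public

vertices : (n : ℕ) → List (Vtx n)
vertices n = cartesianProduct (allFin 4) (allFin n)

orderedEdgeCount : ∀ {n} → SubgraphK4 n → ℕ
orderedEdgeCount {n} G =
  sum (map (λ u → sum (map (λ v → if adj G u v then 1 else 0) (vertices n))) (vertices n))

-- number of edges (each edge counted twice among ordered pairs)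
edgeCount : ∀ {n} → SubgraphK4 n → ℕ
edgeCount G = ⌊ orderedEdgeCount G /2⌋

-- G contains a copy of kK_3: k vertex-disjoint triangles, given by an
-- injective labelling (triangle i, corner a) ↦ vertex, with all three
-- edges of each triangle present in G.
ContainsKK3 : ∀ {n} → ℕ → SubgraphK4 n → Set
ContainsKK3 {n} k G =
  Σ (Fin k × Fin 3 → Vtx n) λ t →
    Injective _≡_ _≡_ t ×
    (∀ i a b → a ≢ b → T (adj G (t (i , a)) (t (i , b))))

-- ex(K_{n,n,n,n}, kK_3) ≥ m  :⇔  some kK_3-free subgraph has ≥ m edges
ExAtLeast : ℕ → ℕ → ℕ → Set
ExAtLeast n k m =
  Σ (SubgraphK4 n) λ G → ¬ ContainsKK3 k G × m Data.Nat.≤ edgeCount G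

module Submission where

-- Write m = k - 1 and group the four parts into two sides,
-- {V₀, V₁} and {V₂, V₃}.  The graph G_m contains every edge between the two
-- sides (4n² edges) together with all edges from the first m vertices of V₀
-- (the special vertices) to V₁ (mn edges).
--
-- By pigeonhole two corners of any triangle lie on the same side;
-- the only edges inside a side are special edges, so every triangle meets
-- one of the m special vertices.  A set of m vertices meeting every triangle
-- bounds the number of vertex-disjoint triangles by m (packing ≤ transversal),
-- so G_m has no copy of (m+1)K₃.

open import Defs hiding (sym)
open import Data.Nat using (ℕ; zero; suc; _+_; _*_; _∸_; _≤_; _<_; s≤s; _<ᵇ_; ⌊_/2⌋)
open import Data.Nat.Properties
  using (*-zeroʳ; *-distribˡ-+; ≤-reflexive; <⇒≤; 1+n≰n; n≡⌊n+n/2⌋; <ᵇ⇒<; n<1+n)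
open import Data.Nat.ListAction using (sum)
open import Data.Nat.ListAction.Properties using (sum-++)
open import Data.Nat.Tactic.RingSolver using (solve-∀)
open import Data.Fin using (Fin; toℕ; fromℕ<; inject≤; zero; suc)
open import Data.Fin.Patterns using (0F; 1F)
open import Data.Fin.Properties
  using (toℕ-fromℕ<; toℕ-inject≤; toℕ-injective; injective⇒≤; pigeonhole; <⇒≢)
open import Data.Bool using (Bool; true; false; if_then_else_; T)
open import Data.Product using (Σ; _×_; _,_; proj₁; proj₂)
open import Data.Sum using (_⊎_; inj₁; inj₂)
open import Data.List using (List; []; _∷_; _++_; map; tabulate; allFin; cartesianProduct)
open import Data.List.Properties using (map-++; map-∘; map-cong; map-tabulate)
open import Function using (_∘_)
open import Function.Definitions using (Injective)
open import Relation.Binary.PropositionalEquality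
  using (_≡_; _≢_; refl; sym; trans; cong; cong₂; module ≡-Reasoning)
open import Relation.Nullary using (¬_)

∑ : ∀ {n} → (Fin n → ℕ) → ℕ
∑ f = sum (tabulate f)

∑-cong : ∀ {n} {f g : Fin n → ℕ} → (∀ i → f i ≡ g i) → ∑ f ≡ ∑ g
∑-cong {zero}  f≗g = refl
∑-cong {suc n} f≗g = cong₂ _+_ (f≗g zero) (∑-cong (f≗g ∘ suc))

∑-const : ∀ n c → ∑ {n} (λ _ → c) ≡ n * c
∑-const zero    c = refl
∑-const (suc n) c = cong (c +_) (∑-const n c)

∑-+ : ∀ {n} (f g : Fin n → ℕ) → ∑ (λ i → f i + g i) ≡ ∑ f + ∑ g
∑-+ {zero}  f g = refl
∑-+ {suc n} f g = begin
  f 0F + g 0F + ∑ (λ i → f (suc i) + g (suc i)) ≡⟨ cong (f 0F + g 0F +_) (∑-+ (f ∘ suc) (g ∘ suc)) ⟩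
  f 0F + g 0F + (∑ (f ∘ suc) + ∑ (g ∘ suc))     ≡⟨ interchange (f 0F) (g 0F) _ _ ⟩
  f 0F + ∑ (f ∘ suc) + (g 0F + ∑ (g ∘ suc))     ∎
  where
  open ≡-Reasoning
  interchange : ∀ a b c d → a + b + (c + d) ≡ a + c + (b + d)
  interchange = solve-∀

∑-*ˡ : ∀ {n} c (f : Fin n → ℕ) → ∑ (λ i → c * f i) ≡ c * ∑ f
∑-*ˡ {zero}  c f = sym (*-zeroʳ c)
∑-*ˡ {suc n} c f =
  trans (cong (c * f 0F +_) (∑-*ˡ c (f ∘ suc))) (sym (*-distribˡ-+ c (f 0F) _))

∑-rectangle : ∀ {a} n (c : Fin a → ℕ) → ∑ (λ p → ∑ {n} (λ _ → c p)) ≡ n * ∑ c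
∑-rectangle n c = trans (∑-cong (λ p → ∑-const n (c p))) (∑-*ˡ n c)

indicator : Bool → ℕ
indicator b = if b then 1 else 0

count-below : ∀ {n m} → m ≤ n → ∑ {n} (λ j → indicator (toℕ j <ᵇ m)) ≡ m
count-below {n} {zero}  _   = trans (∑-const n 0) (*-zeroʳ n)
count-below {suc n} {suc m} (s≤s m≤n) = cong suc (count-below m≤n)

sum-cartesianProduct : ∀ {A B : Set} (g : A × B → ℕ) xs (ys : List B) →
  sum (map g (cartesianProduct xs ys)) ≡ sum (map (λ x → sum (map (λ y → g (x , y)) ys)) xs)
sum-cartesianProduct g []       ys = refl
sum-cartesianProduct g (x ∷ xs) ys = begin
  sum (map g (map (x ,_) ys ++ cartesianProduct xs ys))
    ≡⟨ cong sum (map-++ g (map (x ,_) ys) _) ⟩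
  sum (map g (map (x ,_) ys) ++ map g (cartesianProduct xs ys))
    ≡⟨ sum-++ (map g (map (x ,_) ys)) _ ⟩
  sum (map g (map (x ,_) ys)) + sum (map g (cartesianProduct xs ys))
    ≡⟨ cong₂ _+_ (cong sum (sym (map-∘ ys))) (sum-cartesianProduct g xs ys) ⟩
  sum (map (λ y → g (x , y)) ys) + sum (map (λ x → sum (map (λ y → g (x , y)) ys)) xs) ∎
  where open ≡-Reasoning

sum-allFin : ∀ {n} (g : Fin n → ℕ) → sum (map g (allFin n)) ≡ ∑ g
sum-allFin g = cong sum (map-tabulate (λ i → i) g)

sum-vertices : ∀ {n} (g : Vtx n → ℕ) → sum (map g (vertices n)) ≡ ∑ (λ p → ∑ (λ i → g (p , i)))
sum-vertices {n} g = begin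
  sum (map g (vertices n))
    ≡⟨ sum-cartesianProduct g (allFin 4) (allFin n) ⟩
  sum (map (λ p → sum (map (λ i → g (p , i)) (allFin n))) (allFin 4))
    ≡⟨ cong sum (map-cong (λ p → sum-allFin (λ i → g (p , i))) (allFin 4)) ⟩
  sum (map (λ p → ∑ (λ i → g (p , i))) (allFin 4))
    ≡⟨ sum-allFin (λ p → ∑ (λ i → g (p , i))) ⟩
  ∑ (λ p → ∑ (λ i → g (p , i))) ∎
  where open ≡-Reasoning

IsTriangle : ∀ {n} → SubgraphK4 n → (Fin 3 → Vtx n) → Set
IsTriangle G c = ∀ a b → a ≢ b → T (adj G (c a) (c b))

Transversal : ∀ {n m} → SubgraphK4 n → (Fin m → Vtx n) → Set
Transversal {m = m} G v =
  ∀ c → IsTriangle G c → Σ (Fin 3) λ a → Σ (Fin m) λ s → c a ≡ v s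

-- Disjoint triangles meet a transversal in distinct vertices, so a graph
-- with an m-vertex transversal has at most m vertex-disjoint triangles.
packing≤transversal : ∀ {n m k} {G : SubgraphK4 n} (v : Fin m → Vtx n) →
  Transversal G v → ContainsKK3 k G → k ≤ m
packing≤transversal {m = m} {k} v hit (t , t-injective , triangle) = injective⇒≤ label-injective
  where
  hitAt : ∀ i → Σ (Fin 3) λ a → Σ (Fin m) λ s → t (i , a) ≡ v s
  hitAt i = hit (λ a → t (i , a)) (triangle i)

  label : Fin k → Fin m
  label i = proj₁ (proj₂ (hitAt i))

  label-injective : Injective _≡_ _≡_ label
  label-injective {i} {j} same = cong proj₁ (t-injective (begin
    t (i , proj₁ (hitAt i)) ≡⟨ proj₂ (proj₂ (hitAt i)) ⟩
    v (label i)             ≡⟨ cong v same ⟩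
    v (label j)             ≡⟨ sym (proj₂ (proj₂ (hitAt j))) ⟩
    t (j , proj₁ (hitAt j)) ∎))
    where open ≡-Reasoning

module Construction (n m : ℕ) (m≤n : m ≤ n) where

  special : Fin n → Bool
  special i = toℕ i <ᵇ m

  specialVertex : Fin m → Vtx n
  specialVertex s = 0F , inject≤ s m≤n

  IsSpecial : Vtx n → Set
  IsSpecial u = Σ (Fin m) λ s → u ≡ specialVertex s

  special⇒IsSpecial : ∀ i → T (special i) → IsSpecial (0F , i)
  special⇒IsSpecial i i<m = fromℕ< i<m′ , cong (0F ,_) (toℕ-injective (sym (begin
      toℕ (inject≤ (fromℕ< i<m′) m≤n) ≡⟨ toℕ-inject≤ (fromℕ< i<m′) m≤n ⟩
      toℕ (fromℕ< i<m′)               ≡⟨ toℕ-fromℕ< i<m′ ⟩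
      toℕ i                           ∎)))
    where
    open ≡-Reasoning
    i<m′ : toℕ i < m
    i<m′ = <ᵇ⇒< (toℕ i) m i<m

  side : Fin 4 → Fin 2
  side 0F            = 0F
  side 1F            = 0F
  side (suc (suc _)) = 1F

  adjacency : Vtx n → Vtx n → Bool
  adjacency (0F , _)          (0F , _)          = false
  adjacency (0F , i)          (1F , _)          = special i
  adjacency (1F , _)          (0F , j)          = special j
  adjacency (1F , _)          (1F , _)          = false
  adjacency (0F , _)          (suc (suc _) , _) = true
  adjacency (1F , _)          (suc (suc _) , _) = true
  adjacency (suc (suc _) , _) (0F , _)          = true
  adjacency (suc (suc _) , _) (1F , _)          = true
  adjacency (suc (suc _) , _) (suc (suc _) , _) = false

  adjacency-sym : ∀ u v → adjacency u v ≡ adjacency v u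
  adjacency-sym (0F , _)          (0F , _)          = refl
  adjacency-sym (0F , _)          (1F , _)          = refl
  adjacency-sym (1F , _)          (0F , _)          = refl
  adjacency-sym (1F , _)          (1F , _)          = refl
  adjacency-sym (0F , _)          (suc (suc _) , _) = refl
  adjacency-sym (1F , _)          (suc (suc _) , _) = refl
  adjacency-sym (suc (suc _) , _) (0F , _)          = refl
  adjacency-sym (suc (suc _) , _) (1F , _)          = refl
  adjacency-sym (suc (suc _) , _) (suc (suc _) , _) = refl

  adjacency-host : ∀ u v → T (adjacency u v) → HostAdj u v
  adjacency-host (0F , _)          (1F , _)          _ = λ ()
  adjacency-host (1F , _)          (0F , _)          _ = λ ()
  adjacency-host (0F , _)          (suc (suc _) , _) _ = λ ()
  adjacency-host (1F , _)          (suc (suc _) , _) _ = λ ()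
  adjacency-host (suc (suc _) , _) (0F , _)          _ = λ ()
  adjacency-host (suc (suc _) , _) (1F , _)          _ = λ ()

  G : SubgraphK4 n
  G = record { adj = adjacency ; sym = adjacency-sym ; sub = adjacency-host }

  sameSideEdge : ∀ u v → side (proj₁ u) ≡ side (proj₁ v) → T (adjacency u v) →
                 IsSpecial u ⊎ IsSpecial v
  sameSideEdge (0F , i)          (1F , _)          _  e = inj₁ (special⇒IsSpecial i e)
  sameSideEdge (1F , _)          (0F , j)          _  e = inj₂ (special⇒IsSpecial j e)
  sameSideEdge (0F , _)          (suc (suc _) , _) ()
  sameSideEdge (1F , _)          (suc (suc _) , _) ()
  sameSideEdge (suc (suc _) , _) (0F , _)          ()
  sameSideEdge (suc (suc _) , _) (1F , _)          ()

  -- Two of the three corners of a triangle lie on one side.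
  specialVertices-transversal : Transversal G specialVertex
  specialVertices-transversal c triangle
    with pigeonhole (n<1+n 2) (side ∘ proj₁ ∘ c)
  ... | a , b , a<b , sameSide
    with sameSideEdge (c a) (c b) sameSide (triangle a b (<⇒≢ a<b))
  ...   | inj₁ (s , ca≡) = a , s , ca≡
  ...   | inj₂ (s , cb≡) = b , s , cb≡

  noDisjointTriangles : ∀ {k} → ContainsKK3 k G → k ≤ m
  noDisjointTriangles = packing≤transversal {G = G} specialVertex specialVertices-transversal

  neighbour : Vtx n → Vtx n → ℕ
  neighbour u v = indicator (adjacency u v)

  degree : Vtx n → ℕ
  degree u = sum (map (neighbour u) (vertices n))

  -- Each degree is a sum of four blocks, all constant except the block
  -- from a vertex of part 1 to the special vertices of part 0.
  degree-part₀ : ∀ i → degree (0F , i) ≡ n * (indicator (special i) + 2)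
  degree-part₀ i = trans (sum-vertices (neighbour (0F , i)))
    (∑-rectangle {4} n λ { 0F → 0 ; 1F → indicator (special i) ; (suc (suc _)) → 1 })

  degree-part₁ : ∀ i → degree (1F , i) ≡ m + n * 2
  degree-part₁ i = trans (sum-vertices (neighbour (1F , i)))
    (cong₂ _+_ (count-below m≤n) (∑-rectangle {3} n λ { 0F → 0 ; (suc _) → 1 }))

  degree-side₁ : ∀ p i → degree (suc (suc p) , i) ≡ n * 2
  degree-side₁ p i = trans (sum-vertices (neighbour (suc (suc p) , i)))
    (∑-rectangle {4} n λ { 0F → 1 ; 1F → 1 ; (suc (suc _)) → 0 })

  degreeSum-part₀ : ∑ (λ i → degree (0F , i)) ≡ n * (m + n * 2)
  degreeSum-part₀ = begin
    ∑ (λ i → degree (0F , i))                        ≡⟨ ∑-cong degree-part₀ ⟩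
    ∑ (λ i → n * (indicator (special i) + 2))         ≡⟨ ∑-*ˡ n (λ i → indicator (special i) + 2) ⟩
    n * ∑ (λ i → indicator (special i) + 2)           ≡⟨ cong (n *_) (∑-+ (indicator ∘ special) (λ _ → 2)) ⟩
    n * (∑ (λ i → indicator (special i)) + ∑ {n} (λ _ → 2)) ≡⟨ cong (n *_) (cong₂ _+_ (count-below m≤n) (∑-const n 2)) ⟩
    n * (m + n * 2)                                   ∎
    where open ≡-Reasoning

  degreeSum-part₁ : ∑ (λ i → degree (1F , i)) ≡ n * (m + n * 2)
  degreeSum-part₁ = trans (∑-cong degree-part₁) (∑-const n _)

  degreeSum-side₁ : ∀ p → ∑ (λ i → degree (suc (suc p) , i)) ≡ n * (n * 2)
  degreeSum-side₁ p = trans (∑-cong (degree-side₁ p)) (∑-const n _)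

  orderedEdgeCount-G : orderedEdgeCount G ≡ (4 * (n * n) + m * n) + (4 * (n * n) + m * n)
  orderedEdgeCount-G = begin
    orderedEdgeCount G
      ≡⟨ sum-vertices degree ⟩
    ∑ (λ p → ∑ (λ i → degree (p , i)))
      ≡⟨ cong₂ _+_ degreeSum-part₀ (cong₂ _+_ degreeSum-part₁
           (cong₂ _+_ (degreeSum-side₁ 0F) (cong (_+ 0) (degreeSum-side₁ 1F)))) ⟩
    n * (m + n * 2) + (n * (m + n * 2) + (n * (n * 2) + (n * (n * 2) + 0)))
      ≡⟨ arithmetic n m ⟩
    (4 * (n * n) + m * n) + (4 * (n * n) + m * n) ∎
    where
    open ≡-Reasoning
    arithmetic : ∀ n m → n * (m + n * 2) + (n * (m + n * 2) + (n * (n * 2) + (n * (n * 2) + 0)))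
                       ≡ (4 * (n * n) + m * n) + (4 * (n * n) + m * n)
    arithmetic = solve-∀

  edgeCount-G : edgeCount G ≡ 4 * (n * n) + m * n
  edgeCount-G = trans (cong ⌊_/2⌋ orderedEdgeCount-G) (sym (n≡⌊n+n/2⌋ _))

mainTheorem5 : ∀ (n k : ℕ) → 1 ≤ k → k ≤ n →
    ExAtLeast n k (4 * (n * n) + (k ∸ 1) * n)
mainTheorem5 n zero    () _
mainTheorem5 n (suc m) _  m<n = G , kK₃-free , ≤-reflexive (sym edgeCount-G)
  where
  open Construction n m (<⇒≤ m<n)
  kK₃-free : ¬ ContainsKK3 (suc m) G
  kK₃-free copy = 1+n≰n (noDisjointTriangles copy)
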